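{- Let $n$ be a positive integer and $0\le r\le n$. For every $\pi,\rho\in\mathrm{Sym}_n$, $\bar f_r(\rho\circ\pi)=\bar f_r(\rho)\circ\bar f_s(\pi)$, where $s=[0\,\rho]^{ -1}(r)$ (i.e. $s=\rho^{ -1}(r)$ for $r\ge1$ and $s=0$ for $r=0$).
   Context: $\mathrm{Sym}_n$ is the symmetric group on $[n]$, $(\pi\circ\rho)(t)=\pi(\rho(t))$. For $\pi\in\mathrm{Sym}_n$ let $[0\,\pi]$ be the permutation of $\{0,\dots,n\}$ fixing $0$ and agreeing with $\pi$ on $[n]$, and let $\alpha:x\mapsto x+1\pmod{n+1}$ on $\{0,\dots,n\}$. For $0\le r\le n$ the toric map $\bar f_r:\mathrm{Sym}_n\to\mathrm{Sym}_n$ is defined by $[0\,\bar f_r(\pi)]=\alpha^{n+1-r}\circ[0\,\pi]\circ\alpha^{[0\,\pi]^{ -1}(r)}$. -}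

module Defs where

open import Data.Nat using (ℕ; zero; suc; _∸_)
open import Data.Fin using (Fin; zero; suc; fromℕ; inject₁)
open import Data.Fin.Permutation
  using (Permutation′; permutation; _⟨$⟩ʳ_; _⟨$⟩ˡ_; _∘ₚ_; lift₀; remove; id)
open import Relation.Binary.PropositionalEquality using (_≡_; refl; cong)

-- Sym_n is modelled as Permutation′ n (bijections of Fin n); the point
-- t ∈ [n] = {1,…,n} corresponds to suc (t-1) ∈ Fin (suc n), and 0 ∈ {0,…,n}
-- to zero ∈ Fin (suc n).  So {0,…,n} is Fin (suc n).

-- In the stdlib, (π ∘ₚ ρ) ⟨$⟩ʳ i = ρ ⟨$⟩ʳ (π ⟨$⟩ʳ i) (diagrammatic order).
-- The paper's composition (π ∘ ρ)(t) = π(ρ(t)):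
infixr 9 _∘ˢ_
_∘ˢ_ : ∀ {n} → Permutation′ n → Permutation′ n → Permutation′ n
π ∘ˢ ρ = ρ ∘ₚ π

-- [0 π] : the permutation of {0,…,n} fixing 0 and agreeing with π on [n]
zeroExt : ∀ {n} → Permutation′ n → Permutation′ (suc n)
zeroExt = lift₀

succMod : ∀ {n} → Fin (suc n) → Fin (suc n)
succMod {zero} zero = zero
succMod {suc n} zero = suc zero
succMod {suc n} (suc i) with succMod {n} i
... | zero = zero
... | suc j = suc (suc j)

predMod : ∀ {n} → Fin (suc n) → Fin (suc n)
predMod {n} zero = fromℕ n
predMod {n} (suc i) = inject₁ i

private
  succ-fromℕ : ∀ n → succMod (fromℕ n) ≡ zero
  succ-fromℕ zero = refl
  succ-fromℕ (suc n) rewrite succ-fromℕ n = refl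

  succ-inject : ∀ {n} (i : Fin n) → succMod (inject₁ i) ≡ suc i
  succ-inject {suc n} zero = refl
  succ-inject {suc n} (suc i) rewrite succ-inject i = refl

  sp : ∀ {n} (x : Fin (suc n)) → succMod (predMod x) ≡ x
  sp {n} zero = succ-fromℕ n
  sp (suc i) = succ-inject i

  ps : ∀ {n} (x : Fin (suc n)) → predMod (succMod x) ≡ x
  ps {zero} zero = refl
  ps {suc n} zero = refl
  ps {suc n} (suc i) with succMod {n} i | ps {n} i
  ... | zero | e = cong suc e
  ... | suc j | e = cong suc e

α : ∀ {n} → Permutation′ (suc n)
α = permutation succMod predMod sp ps

_^ₚ_ : ∀ {n} → Permutation′ n → ℕ → Permutation′ n
π ^ₚ zero = id
π ^ₚ suc k = π ∘ˢ (π ^ₚ k)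

open import Data.Fin using (toℕ)

toricExt : ∀ {n} → Fin (suc n) → Permutation′ n → Permutation′ (suc n)
toricExt {n} r π =
  (α ^ₚ (suc n ∸ toℕ r)) ∘ˢ zeroExt π ∘ˢ (α ^ₚ toℕ (zeroExt π ⟨$⟩ˡ r))

-- The toric map f̄_r : Sym_n → Sym_n.  toricExt r π fixes 0 (this is the
-- implicit claim in the definition), and f̄_r(π) is its restriction to [n],
-- i.e. [0 f̄_r(π)] = toricExt r π.  `remove 0F` is exactly that restriction
-- for permutations fixing 0 (stdlib lemma lift₀-remove).
toric : ∀ {n} → Fin (suc n) → Permutation′ n → Permutation′ n
toric r π = remove zero (toricExt r π)

-- Conjugating by powers of the rotation α, the toric construction is a
-- "twisted" homomorphism already on all of Sym {0,…,n}: in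
--   α^{-r} ρπ α^{(ρπ)⁻¹ r}  =  (α^{-r} ρ α^{ρ⁻¹ r}) ∘ (α^{-s} π α^{π⁻¹ s}),  s = ρ⁻¹ r,
-- the inner factors α^{s} α^{-s} cancel because α has order n + 1.  Each
-- conjugate fixes 0, and restriction to [n] is multiplicative on the
-- stabiliser of 0, so the identity descends to f̄_r.
module Submission where

open import Defs
open import Data.Nat using (ℕ; zero; suc; _≤_; _+_; _∸_; _%_; NonZero)
open import Data.Nat.Properties using (+-comm; m∸n+n≡m; m+[n∸m]≡n; <⇒≤)
open import Data.Nat.DivMod using (%-distribˡ-+; m%n%n≡m%n; m<n⇒m%n≡m; n%n≡0; [m+n]%n≡m%n)
open import Data.Fin using (Fin; zero; suc; toℕ; fromℕ; inject₁)
open import Data.Fin.Properties using (toℕ-injective; toℕ<n; toℕ-fromℕ; toℕ-inject₁; suc-injective)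
open import Data.Fin.Relation.Unary.Top using (view; ‵fromℕ; ‵inject₁)
open import Data.Fin.Permutation
  using (Permutation′; _≈_; _⟨$⟩ʳ_; _⟨$⟩ˡ_; inverseˡ; inverseʳ; id; lift₀-comp; lift₀-remove; remove)
open import Relation.Binary.PropositionalEquality using (_≡_; refl; sym; trans; cong)
open Relation.Binary.PropositionalEquality.≡-Reasoning

[1+m%n]%n≡[1+m]%n : ∀ m n .{{_ : NonZero n}} → suc (m % n) % n ≡ suc m % n
[1+m%n]%n≡[1+m]%n m n = begin
  (1 + m % n) % n           ≡⟨ %-distribˡ-+ 1 (m % n) n ⟩
  (1 % n + m % n % n) % n   ≡⟨ cong (λ k → (1 % n + k) % n) (m%n%n≡m%n m n) ⟩
  (1 % n + m % n) % n       ≡⟨ %-distribˡ-+ 1 m n ⟨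
  (1 + m) % n               ∎

^ₚ-+ : ∀ {n} (π : Permutation′ n) a b x → π ^ₚ (a + b) ⟨$⟩ʳ x ≡ π ^ₚ a ⟨$⟩ʳ (π ^ₚ b ⟨$⟩ʳ x)
^ₚ-+ π zero    b x = refl
^ₚ-+ π (suc a) b x = cong (π ⟨$⟩ʳ_) (^ₚ-+ π a b x)

^ₚ-cancel : ∀ {n d} (π : Permutation′ n) → π ^ₚ d ≈ id →
  ∀ a b → a + b ≡ d → ∀ x → π ^ₚ a ⟨$⟩ʳ (π ^ₚ b ⟨$⟩ʳ x) ≡ x
^ₚ-cancel π πᵈ≈id a b refl x = trans (sym (^ₚ-+ π a b x)) (πᵈ≈id x)

⟨$⟩ˡ-cong : ∀ {n} (σ τ : Permutation′ n) → σ ≈ τ → ∀ i → σ ⟨$⟩ˡ i ≡ τ ⟨$⟩ˡ i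
⟨$⟩ˡ-cong σ τ σ≈τ i = begin
  σ ⟨$⟩ˡ i                        ≡⟨ inverseˡ τ ⟨
  τ ⟨$⟩ˡ (τ ⟨$⟩ʳ (σ ⟨$⟩ˡ i))       ≡⟨ cong (τ ⟨$⟩ˡ_) (σ≈τ (σ ⟨$⟩ˡ i)) ⟨
  τ ⟨$⟩ˡ (σ ⟨$⟩ʳ (σ ⟨$⟩ˡ i))       ≡⟨ cong (τ ⟨$⟩ˡ_) (inverseʳ σ) ⟩
  τ ⟨$⟩ˡ i                        ∎

remove₀-∘ˢ : ∀ {n} (σ τ υ : Permutation′ (suc n)) → σ ≈ τ ∘ˢ υ →
  τ ⟨$⟩ʳ zero ≡ zero → υ ⟨$⟩ʳ zero ≡ zero →
  remove zero σ ≈ remove zero τ ∘ˢ remove zero υ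
remove₀-∘ˢ σ τ υ σ≈τυ τ₀ υ₀ j = suc-injective (begin
  suc (remove zero σ ⟨$⟩ʳ j)                       ≡⟨ lift₀-remove σ σ₀ (suc j) ⟩
  σ ⟨$⟩ʳ suc j                                     ≡⟨ σ≈τυ (suc j) ⟩
  τ ⟨$⟩ʳ (υ ⟨$⟩ʳ suc j)                            ≡⟨ cong (τ ⟨$⟩ʳ_) (lift₀-remove υ υ₀ (suc j)) ⟨
  τ ⟨$⟩ʳ suc (remove zero υ ⟨$⟩ʳ j)                ≡⟨ lift₀-remove τ τ₀ (suc _) ⟨
  suc (remove zero τ ⟨$⟩ʳ (remove zero υ ⟨$⟩ʳ j))  ∎)
  where
  σ₀ : σ ⟨$⟩ʳ zero ≡ zero
  σ₀ = trans (σ≈τυ zero) (trans (cong (τ ⟨$⟩ʳ_) υ₀) τ₀)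

succMod-fromℕ : ∀ n → succMod (fromℕ n) ≡ zero
succMod-fromℕ zero    = refl
succMod-fromℕ (suc n) rewrite succMod-fromℕ n = refl

succMod-inject₁ : ∀ {n} (i : Fin n) → succMod (inject₁ i) ≡ suc i
succMod-inject₁ {suc n} zero    = refl
succMod-inject₁ {suc n} (suc i) rewrite succMod-inject₁ i = refl

toℕ-succMod : ∀ {n} (x : Fin (suc n)) → toℕ (succMod x) ≡ suc (toℕ x) % suc n
toℕ-succMod {n} x with view x
... | ‵fromℕ rewrite succMod-fromℕ n | toℕ-fromℕ n = sym (n%n≡0 (suc n))
... | ‵inject₁ i rewrite succMod-inject₁ i | toℕ-inject₁ i = sym (m<n⇒m%n≡m (toℕ<n (suc i)))

toℕ-α^ : ∀ {n} m (x : Fin (suc n)) → toℕ (α ^ₚ m ⟨$⟩ʳ x) ≡ (m + toℕ x) % suc n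
toℕ-α^ {n} zero    x = sym (m<n⇒m%n≡m (toℕ<n x))
toℕ-α^ {n} (suc m) x = begin
  toℕ (succMod (α ^ₚ m ⟨$⟩ʳ x))       ≡⟨ toℕ-succMod (α ^ₚ m ⟨$⟩ʳ x) ⟩
  suc (toℕ (α ^ₚ m ⟨$⟩ʳ x)) % suc n    ≡⟨ cong (λ k → suc k % suc n) (toℕ-α^ m x) ⟩
  suc ((m + toℕ x) % suc n) % suc n   ≡⟨ [1+m%n]%n≡[1+m]%n (m + toℕ x) (suc n) ⟩
  suc (m + toℕ x) % suc n             ∎

α^-order : ∀ {n} → α ^ₚ suc n ≈ id {suc n}
α^-order {n} x = toℕ-injective (begin
  toℕ (α ^ₚ suc n ⟨$⟩ʳ x)   ≡⟨ toℕ-α^ (suc n) x ⟩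
  (suc n + toℕ x) % suc n   ≡⟨ cong (_% suc n) (+-comm (suc n) (toℕ x)) ⟩
  (toℕ x + suc n) % suc n   ≡⟨ [m+n]%n≡m%n (toℕ x) (suc n) ⟩
  toℕ x % suc n             ≡⟨ m<n⇒m%n≡m (toℕ<n x) ⟩
  toℕ x                     ∎)

α^-zero : ∀ {n} (y : Fin (suc n)) → α ^ₚ toℕ y ⟨$⟩ʳ zero ≡ y
α^-zero {n} y = toℕ-injective (trans (toℕ-α^ (toℕ y) zero)
  (trans (cong (_% suc n) (+-comm (toℕ y) 0)) (m<n⇒m%n≡m (toℕ<n y))))

toricConj : ∀ {n} → Fin (suc n) → Permutation′ (suc n) → Permutation′ (suc n)
toricConj {n} r σ = (α ^ₚ (suc n ∸ toℕ r)) ∘ˢ σ ∘ˢ (α ^ₚ toℕ (σ ⟨$⟩ˡ r))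

toricConj-fixes-zero : ∀ {n} r (σ : Permutation′ (suc n)) → toricConj r σ ⟨$⟩ʳ zero ≡ zero
toricConj-fixes-zero {n} r σ = begin
  α ^ₚ (suc n ∸ toℕ r) ⟨$⟩ʳ (σ ⟨$⟩ʳ (α ^ₚ toℕ (σ ⟨$⟩ˡ r) ⟨$⟩ʳ zero))
    ≡⟨ cong (λ y → α ^ₚ (suc n ∸ toℕ r) ⟨$⟩ʳ (σ ⟨$⟩ʳ y)) (α^-zero (σ ⟨$⟩ˡ r)) ⟩
  α ^ₚ (suc n ∸ toℕ r) ⟨$⟩ʳ (σ ⟨$⟩ʳ (σ ⟨$⟩ˡ r))
    ≡⟨ cong (α ^ₚ (suc n ∸ toℕ r) ⟨$⟩ʳ_) (inverseʳ σ) ⟩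
  α ^ₚ (suc n ∸ toℕ r) ⟨$⟩ʳ r
    ≡⟨ cong (α ^ₚ (suc n ∸ toℕ r) ⟨$⟩ʳ_) (α^-zero r) ⟨
  α ^ₚ (suc n ∸ toℕ r) ⟨$⟩ʳ (α ^ₚ toℕ r ⟨$⟩ʳ zero)
    ≡⟨ ^ₚ-cancel α α^-order (suc n ∸ toℕ r) (toℕ r) (m∸n+n≡m (<⇒≤ (toℕ<n r))) zero ⟩
  zero ∎

toricConj-cong : ∀ {n} r (σ τ : Permutation′ (suc n)) → σ ≈ τ → toricConj r σ ≈ toricConj r τ
toricConj-cong {n} r σ τ σ≈τ x = begin
  α ^ₚ (suc n ∸ toℕ r) ⟨$⟩ʳ (σ ⟨$⟩ʳ (α ^ₚ toℕ (σ ⟨$⟩ˡ r) ⟨$⟩ʳ x))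
    ≡⟨ cong (λ i → α ^ₚ (suc n ∸ toℕ r) ⟨$⟩ʳ (σ ⟨$⟩ʳ (α ^ₚ toℕ i ⟨$⟩ʳ x))) (⟨$⟩ˡ-cong σ τ σ≈τ r) ⟩
  α ^ₚ (suc n ∸ toℕ r) ⟨$⟩ʳ (σ ⟨$⟩ʳ (α ^ₚ toℕ (τ ⟨$⟩ˡ r) ⟨$⟩ʳ x))
    ≡⟨ cong (α ^ₚ (suc n ∸ toℕ r) ⟨$⟩ʳ_) (σ≈τ _) ⟩
  α ^ₚ (suc n ∸ toℕ r) ⟨$⟩ʳ (τ ⟨$⟩ʳ (α ^ₚ toℕ (τ ⟨$⟩ˡ r) ⟨$⟩ʳ x)) ∎

toricConj-∘ˢ : ∀ {n} r (σ τ : Permutation′ (suc n)) →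
  toricConj r (σ ∘ˢ τ) ≈ toricConj r σ ∘ˢ toricConj (σ ⟨$⟩ˡ r) τ
toricConj-∘ˢ {n} r σ τ x =
  cong (λ y → α ^ₚ (suc n ∸ toℕ r) ⟨$⟩ʳ (σ ⟨$⟩ʳ y))
       (sym (^ₚ-cancel α α^-order s (suc n ∸ s) (m+[n∸m]≡n (<⇒≤ (toℕ<n (σ ⟨$⟩ˡ r)))) _))
  where s = toℕ (σ ⟨$⟩ˡ r)

toricExt-∘ˢ : ∀ {n} r (π ρ : Permutation′ n) →
  toricExt r (ρ ∘ˢ π) ≈ toricExt r ρ ∘ˢ toricExt (zeroExt ρ ⟨$⟩ˡ r) π
toricExt-∘ˢ r π ρ x =
  trans (toricConj-cong r (zeroExt (ρ ∘ˢ π)) (zeroExt ρ ∘ˢ zeroExt π) (λ y → sym (lift₀-comp π ρ y)) x)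
        (toricConj-∘ˢ r (zeroExt ρ) (zeroExt π) x)

lemma4 : (n : ℕ) → 1 ≤ n → (r : Fin (suc n)) → (π ρ : Permutation′ n) →
    toric r (ρ ∘ˢ π) ≈ (toric r ρ ∘ˢ toric (zeroExt ρ ⟨$⟩ˡ r) π)
lemma4 n _ r π ρ =
  remove₀-∘ˢ (toricExt r (ρ ∘ˢ π)) (toricExt r ρ) (toricExt s π) (toricExt-∘ˢ r π ρ)
    (toricConj-fixes-zero r (zeroExt ρ)) (toricConj-fixes-zero s (zeroExt π))
  where
  s = zeroExt ρ ⟨$⟩ˡ r
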